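{- For every $\mathrm{k}\in\mathbb{N}$, the following problem (EL-k Marking Persistence Problem) is decidable: given a place/transition net $\mathrm{S}=(P,T,F,M_0)$ and a marking $M\in\mathbb{N}^P$, decide whether $M$ is e/l-$\mathrm{k}$-persistent.
   Context: A place/transition net (p/t-net) is $\mathrm{S}=(P,T,F,M_0)$ where $P$ (places) and $T$ (transitions) are finite disjoint sets, $F\subseteq P\times T\cup T\times P$ is the flow relation, and $M_0\in\mathbb{N}^P$ is the initial marking. Markings are vectors in $\mathbb{N}^P$, ordered and added componentwise. For $a\in T$, ${}^\bullet a\in\mathbb{N}^P$ is the vector with $1$ at places $p$ with $(p,a)\in F$ and $0$ elsewhere; $a^\bullet$ is the vector with $1$ at places $p$ with $(a,p)\in F$ and $0$ elsewhere. A transition $a$ is enabled in $M$ (written $Ma$) iff ${}^\bullet a\le M$; then firing $a$ yields $M'=(M-{}^\bullet a)+a^\bullet$ (written $MaM'$). This is extended to strings $w\in T^*$: $M\varepsilon M$, and $MvaM''$ iff $MvM'$ and $M'aM''$ for some $M'$; $Mw$ means $MwM'$ for some $M'$. For $\mathrm{k}\in\mathbb{N}$, a step $Ma$ (with $a$ enabled in $M$) is e/l-$\mathrm{k}$-persistent iff for every $b\in T$, $b\neq a$, $Mb$ implies that there exists $w\in T^*$ with $|w|\le\mathrm{k}$ and $Mawb$. A marking $M$ is e/l-$\mathrm{k}$-persistent iff for every $a\in T$ enabled in $M$ the step $Ma$ is e/l-$\mathrm{k}$-persistent. -}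

module Defs where

open import Data.Nat using (ℕ; _+_; _∸_; _≤_)
open import Data.Bool using (Bool; true; false; if_then_else_)
open import Data.Fin using (Fin)
open import Data.List using (List; []; _∷_; length; _++_)
open import Data.Product using (Σ; ∃; _×_; _,_)
open import Relation.Binary.PropositionalEquality using (_≡_)
open import Relation.Nullary using (¬_)

-- The flow relation F ⊆ P×T ∪ T×P is given by its two (decidable) characteristic
-- functions: pre p a = true iff (p,a) ∈ F, post a p = true iff (a,p) ∈ F.
record Net : Set where
  field
    nP   : ℕ
    nT   : ℕ
    pre  : Fin nP → Fin nT → Bool
    post : Fin nT → Fin nP → Bool
    M₀   : Fin nP → ℕ

open Net public

Place : Net → Set
Place S = Fin (nP S)

Transition : Net → Set
Transition S = Fin (nT S)

Marking : Net → Set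
Marking S = Place S → ℕ

χ : Bool → ℕ
χ true  = 1
χ false = 0

•_ : {S : Net} → Transition S → Marking S
•_ {S} a p = χ (pre S p a)

_• : {S : Net} → Transition S → Marking S
_• {S} a p = χ (post S a p)

_≤ₘ_ : {S : Net} → Marking S → Marking S → Set
_≤ₘ_ {S} M M′ = (p : Place S) → M p ≤ M′ p

Enabled : (S : Net) → Marking S → Transition S → Set
Enabled S M a = _≤ₘ_ {S} (•_ {S} a) M

Fires : (S : Net) → Marking S → Transition S → Marking S → Set
Fires S M a M′ = Enabled S M a × ((p : Place S) → M′ p ≡ (M p ∸ (•_ {S} a) p) + (_• {S} a) p)

-- M w M′ for strings w ∈ T*: M ε M, and M (a w) M″ iff M a M′ and M′ w M″
-- (equivalent to the left-extension in the paper's definition).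
data FiresSeq (S : Net) : Marking S → List (Transition S) → Marking S → Set where
  ε-fire : ∀ {M} → FiresSeq S M [] M
  ∷-fire : ∀ {M M′ M″ a w} → Fires S M a M′ → FiresSeq S M′ w M″ → FiresSeq S M (a ∷ w) M″

FirableSeq : (S : Net) → Marking S → List (Transition S) → Set
FirableSeq S M w = ∃ λ M′ → FiresSeq S M w M′

ELkPersistentStep : ℕ → (S : Net) → Marking S → Transition S → Set
ELkPersistentStep k S M a =
  (b : Transition S) → ¬ (b ≡ a) → Enabled S M b →
  Σ (List (Transition S)) λ w → (length w ≤ k) × FirableSeq S M (a ∷ w ++ (b ∷ []))

ELkPersistentMarking : ℕ → (S : Net) → Marking S → Set
ELkPersistentMarking k S M =
  (a : Transition S) → Enabled S M a → ELkPersistentStep k S M a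

-- Everything is decidable by exhaustive search: enabledness is a finite conjunction
-- of comparisons, firing is deterministic, and there are finitely many words of
-- length at most k over the finite alphabet of transitions.

module Submission where

open import Defs
open import Data.Nat using (ℕ; zero; suc; _≤_; _≤?_; _∸_; _+_; z≤n; s≤s)
open import Data.Fin using (Fin; _≟_)
open import Data.Fin.Properties using (all?; any?)
open import Data.List using (List; []; _∷_; length; _++_)
open import Data.Product using (∃-syntax; _×_; _,_)
open import Relation.Nullary using (Dec; yes; no)
open import Relation.Nullary.Decidable using (_→-dec_; ¬?)
open import Relation.Binary.PropositionalEquality using (_≗_; refl; subst; trans; cong)

enabled? : (S : Net) (M : Marking S) (a : Transition S) → Dec (Enabled S M a)
enabled? S M a = all? λ p → (•_ {S} a) p ≤? M p

fire : (S : Net) → Marking S → Transition S → Marking S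
fire S M a p = (M p ∸ (•_ {S} a) p) + (_• {S} a) p

firableSeq-resp-≗ : (S : Net) {M N : Marking S} → M ≗ N →
  (w : List (Transition S)) → FirableSeq S M w → FirableSeq S N w
firableSeq-resp-≗ S M≗N []      _ = _ , ε-fire
firableSeq-resp-≗ S M≗N (a ∷ w) (M″ , ∷-fire (enabled , step) rest) =
  M″ , ∷-fire ( (λ p → subst ((•_ {S} a) p ≤_) (M≗N p) (enabled p))
              , (λ p → trans (step p) (cong (λ m → (m ∸ (•_ {S} a) p) + (_• {S} a) p) (M≗N p))))
              rest

firableSeq? : (S : Net) (M : Marking S) (w : List (Transition S)) → Dec (FirableSeq S M w)
firableSeq? S M []      = yes (M , ε-fire)
firableSeq? S M (a ∷ w) with enabled? S M a
... | no ¬enabled = no λ { (_ , ∷-fire (enabled , _) _) → ¬enabled enabled }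
... | yes enabled with firableSeq? S (fire S M a) w
...   | yes (M″ , rest) = yes (M″ , ∷-fire (enabled , λ _ → refl) rest)
...   | no ¬rest = no λ { (M″ , ∷-fire (_ , step) rest) →
                         ¬rest (firableSeq-resp-≗ S step w (M″ , rest)) }

∃-length≤? : ∀ {n} {P : List (Fin n) → Set} → (∀ w → Dec (P w)) →
  (k : ℕ) → Dec (∃[ w ] length w ≤ k × P w)
∃-length≤? P? k with P? []
... | yes p = yes ([] , z≤n , p)
∃-length≤? P? zero    | no ¬p = no λ { ([] , _ , p) → ¬p p ; (_ ∷ _ , () , _) }
∃-length≤? P? (suc k) | no ¬p with any? (λ a → ∃-length≤? (λ w → P? (a ∷ w)) k)
... | yes (a , w , l , p) = yes (a ∷ w , s≤s l , p)
... | no ¬q = no λ { ([] , _ , p) → ¬p p ; (a ∷ w , s≤s l , p) → ¬q (a , w , l , p) }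

elkPersistentStep? : (k : ℕ) (S : Net) (M : Marking S) (a : Transition S) →
  Dec (ELkPersistentStep k S M a)
elkPersistentStep? k S M a =
  all? λ b → ¬? (b ≟ a) →-dec enabled? S M b →-dec
    ∃-length≤? (λ w → firableSeq? S M (a ∷ w ++ b ∷ [])) k

theorem4 : (k : ℕ) → (S : Net) → (M : Marking S) → Dec (ELkPersistentMarking k S M)
theorem4 k S M = all? λ a → enabled? S M a →-dec elkPersistentStep? k S M a
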